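{- Let $R$ be a ring, $I$ an ideal of $R$, and $M$ and $\{M_\lambda\}_{\lambda\in\Lambda}$ $R$-modules. (1) $H_R(I,\prod_{\lambda\in\Lambda}M_\lambda)=\prod_{\lambda\in\Lambda}H_R(I,M_\lambda)$. (2) If $I$ is finitely generated, then $H_R(I,\bigoplus_{\lambda\in\Lambda}M_\lambda)=\bigoplus_{\lambda\in\Lambda}H_R(I,M_\lambda)$. (3) If $J=\mathrm{ann}(M)$, then $H_R(I,M)=H_{R/J}((I+J)/J,M)$. (4) If $S\subseteq R$ is a multiplicative set and $I$ is finitely generated, then $S^{ -1}H_R(I,M)$ is (via the natural localisation map) a submodule of $H_{S^{ -1}R}(S^{ -1}I,S^{ -1}M)$.
   Context: Rings are commutative with unit. For an ideal $I$ of $R$ and an $R$-module $M$: $Z_R(I,M)=\{\varphi\in\mathrm{Hom}_R(I,M):\varphi(t)\in tM\text{ for all }t\in I\}$; $B_R(I,M)$ is the submodule of those $\varphi\in Z_R(I,M)$ for which there exists $m\in M$ with $\varphi(t)=tm$ for all $t\in I$ (principal homomorphisms); $H_R(I,M)=Z_R(I,M)/B_R(I,M)$. In (3), $M$ is regarded as an $R/J$-module. -}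

module Defs where

open import Level using (0ℓ)
open import Algebra.Bundles using (CommutativeRing; RawRing)
open import Algebra.Module.Bundles using (Module)
open import Algebra.Module.Bundles.Raw using (RawLeftModule)
open import Relation.Unary using (Pred)
open import Data.Product using (Σ; Σ-syntax; _×_; _,_; proj₁; proj₂)
open import Data.Nat as ℕ using (ℕ)
open import Data.Fin as F using (Fin)
open import Data.List using (List; []; _++_)
open import Data.List.Membership.Propositional using (_∈_)
open import Data.Sum using (_⊎_; inj₁; inj₂)
import Data.Sum
open import Data.List.Membership.Propositional.Properties using (∈-++⁺ˡ; ∈-++⁺ʳ)
import Algebra.Properties.AbelianGroup as AbGroupProps

-- Quotients are not available in Agda, so a
-- module such as H_R(I,M) = Z_R(I,M)/B_R(I,M) is presented by its
-- representatives Z_R(I,M) together with the relation "difference lies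
-- in B_R(I,M)".

record PMod (A : Set) : Set₁ where
  field
    Elt  : Set
    Good : Elt → Set
    _≈_  : Elt → Elt → Set
    _+_  : Elt → Elt → Elt
    0e   : Elt
    _·_  : A → Elt → Elt

record IsIso {A : Set} (P Q : PMod A) (F : PMod.Elt P → PMod.Elt Q) : Set where
  private
    module P = PMod P
    module Q = PMod Q
  field
    good : ∀ x → P.Good x → Q.Good (F x)
    resp : ∀ x y → P.Good x → P.Good y → x P.≈ y → F x Q.≈ F y
    add  : ∀ x y → P.Good x → P.Good y → F (x P.+ y) Q.≈ (F x Q.+ F y)
    hom  : ∀ a x → P.Good x → F (a P.· x) Q.≈ (a Q.· F x)
    inj  : ∀ x y → P.Good x → P.Good y → F x Q.≈ F y → x P.≈ y
    surj : ∀ y → Q.Good y → Σ[ x ∈ P.Elt ] (P.Good x × F x Q.≈ y)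

record IsEmbedding {A : Set} (P Q : PMod A) (F : PMod.Elt P → PMod.Elt Q) : Set where
  private
    module P = PMod P
    module Q = PMod Q
  field
    good : ∀ x → P.Good x → Q.Good (F x)
    resp : ∀ x y → P.Good x → P.Good y → x P.≈ y → F x Q.≈ F y
    add  : ∀ x y → P.Good x → P.Good y → F (x P.+ y) Q.≈ (F x Q.+ F y)
    hom  : ∀ a x → P.Good x → F (a P.· x) Q.≈ (a Q.· F x)
    inj  : ∀ x y → P.Good x → P.Good y → F x Q.≈ F y → x P.≈ y

ΠP : {A : Set} (Λ : Set) → (Λ → PMod A) → PMod A
ΠP Λ P = record
  { Elt  = (λ' : Λ) → PMod.Elt (P λ')
  ; Good = λ x → (λ' : Λ) → PMod.Good (P λ') (x λ')
  ; _≈_  = λ x y → (λ' : Λ) → PMod._≈_ (P λ') (x λ') (y λ')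
  ; _+_  = λ x y λ' → PMod._+_ (P λ') (x λ') (y λ')
  ; 0e   = λ λ' → PMod.0e (P λ')
  ; _·_  = λ a x λ' → PMod._·_ (P λ') a (x λ')
  }

-- x has finite support: there is a finite list L of indices such that
-- every index either lies in L or x is zero there.  (Classically the same
-- as "x is zero outside L"; this form does not require decidable
-- equality on Λ to split a family along L.)
FinSupp : {A : Set} (Λ : Set) (P : Λ → PMod A) → PMod.Elt (ΠP Λ P) → Set
FinSupp Λ P x = Σ[ L ∈ List Λ ] ((λ' : Λ) → λ' ∈ L ⊎ PMod._≈_ (P λ') (x λ') (PMod.0e (P λ')))

⊕P : {A : Set} (Λ : Set) → (Λ → PMod A) → PMod A
⊕P Λ P = record
  { Elt  = PMod.Elt (ΠP Λ P)
  ; Good = λ x → PMod.Good (ΠP Λ P) x × FinSupp Λ P x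
  ; _≈_  = PMod._≈_ (ΠP Λ P)
  ; _+_  = PMod._+_ (ΠP Λ P)
  ; 0e   = PMod.0e (ΠP Λ P)
  ; _·_  = PMod._·_ (ΠP Λ P)
  }

module HTheory (R : RawRing 0ℓ 0ℓ) (M : RawLeftModule (RawRing.Carrier R) 0ℓ 0ℓ)
               (I : Pred (RawRing.Carrier R) 0ℓ) where
  open RawRing R
  open RawLeftModule M

  Fn : Set
  Fn = (t : Carrier) → I t → Carrierᴹ

  record IsHom (f : Fn) : Set where
    field
      cong        : ∀ {t u} (p : I t) (q : I u) → t ≈ u → f t p ≈ᴹ f u q
      additive    : ∀ {t u} (p : I t) (q : I u) (r : I (t + u)) →
                    f (t + u) r ≈ᴹ (f t p +ᴹ f u q)
      homogeneous : ∀ a {t} (p : I t) (q : I (a * t)) → f (a * t) q ≈ᴹ (a *ₗ f t p)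

  IsLocal : Fn → Set
  IsLocal f = ∀ t (p : I t) → Σ[ m ∈ Carrierᴹ ] (f t p ≈ᴹ (t *ₗ m))

  IsZ : Fn → Set
  IsZ f = IsHom f × IsLocal f

  IsB : Fn → Set
  IsB f = Σ[ m ∈ Carrierᴹ ] (∀ t (p : I t) → f t p ≈ᴹ (t *ₗ m))

  _⊕_ : Fn → Fn → Fn
  (f ⊕ g) t p = f t p +ᴹ g t p

  ⊖_ : Fn → Fn
  (⊖ f) t p = -ᴹ f t p

  _∙_ : Carrier → Fn → Fn
  (a ∙ f) t p = a *ₗ f t p

  0F : Fn
  0F t p = 0ᴹ

  _∼_ : Fn → Fn → Set
  f ∼ g = IsB (f ⊕ (⊖ g))

  H : PMod Carrier
  H = record { Elt = Fn ; Good = IsZ ; _≈_ = _∼_ ; _+_ = _⊕_ ; 0e = 0F ; _·_ = _∙_ }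

module _ (R : CommutativeRing 0ℓ 0ℓ) where
  open CommutativeRing R hiding (zero)

  record IsIdeal (I : Pred Carrier 0ℓ) : Set where
    field
      resp  : ∀ {x y} → x ≈ y → I x → I y
      zero∈ : I 0#
      +∈    : ∀ {x y} → I x → I y → I (x + y)
      *∈    : ∀ r {x} → I x → I (r * x)

  record IsMultSet (S : Pred Carrier 0ℓ) : Set where
    field
      resp : ∀ {x y} → x ≈ y → S x → S y
      one∈ : S 1#
      *∈   : ∀ {x y} → S x → S y → S (x * y)

  sumFin : ∀ n → (Fin n → Carrier) → Carrier
  sumFin ℕ.zero    c = 0#
  sumFin (ℕ.suc n) c = c F.zero + sumFin n (λ i → c (F.suc i))

  FinGen : Pred Carrier 0ℓ → Set
  FinGen I = Σ[ n ∈ ℕ ] Σ[ g ∈ (Fin n → Carrier) ]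
               (((i : Fin n) → I (g i)) ×
                (∀ t → I t → Σ[ c ∈ (Fin n → Carrier) ] (t ≈ sumFin n (λ i → c i * g i))))

  _+ᴵ_ : Pred Carrier 0ℓ → Pred Carrier 0ℓ → Pred Carrier 0ℓ
  (I +ᴵ J) x = Σ[ a ∈ Carrier ] Σ[ b ∈ Carrier ] (I a × J b × x ≈ (a + b))

  H_R : (M : Module R 0ℓ 0ℓ) → Pred Carrier 0ℓ → PMod Carrier
  H_R M I = HTheory.H rawRing (Module.rawLeftModule M) I

  module _ (M : Module R 0ℓ 0ℓ) where
    open Module M

    ann : Pred Carrier 0ℓ
    ann r = ∀ m → (r *ₗ m) ≈ᴹ 0ᴹ

  quotRing : Pred Carrier 0ℓ → RawRing 0ℓ 0ℓ
  quotRing J = record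
    { Carrier = Carrier ; _≈_ = λ x y → J (x - y) ; _+_ = _+_ ; _*_ = _*_
    ; -_ = -_ ; 0# = 0# ; 1# = 1# }

  -- H_{R/J}((I+J)/J, M) : M regarded as R/J-module (same action),
  -- (I+J)/J given by the predicate I+J on representatives.
  H_quot : (M : Module R 0ℓ 0ℓ) → (I J : Pred Carrier 0ℓ) → PMod Carrier
  H_quot M I J = HTheory.H (quotRing J) (Module.rawLeftModule M) (I +ᴵ J)

  restrict : (M : Module R 0ℓ 0ℓ) → (I : Pred Carrier 0ℓ) →
             PMod.Elt (H_quot M I (ann M)) → PMod.Elt (H_R M I)
  restrict M I ψ t p = ψ t (t , 0# , p , (λ m → Module.*ₗ-zeroˡ M m) , sym (+-identityʳ t))

  module Loc (S : Pred Carrier 0ℓ) (mS : IsMultSet S) where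
    open IsMultSet mS renaming (*∈ to *S; one∈ to oneS)

    Den : Set
    Den = Σ[ s ∈ Carrier ] S s

    _*D_ : Den → Den → Den
    (s , p) *D (u , q) = (s * u , *S p q)

    1D : Den
    1D = (1# , oneS)

    locRing : RawRing 0ℓ 0ℓ
    locRing = record
      { Carrier = Carrier × Den
      ; _≈_ = λ { (a , s) (b , u) → Σ[ v ∈ Den ] ((proj₁ v * proj₁ u) * a ≈ (proj₁ v * proj₁ s) * b) }
      ; _+_ = λ { (a , s) (b , u) → ((a * proj₁ u) + (b * proj₁ s) , s *D u) }
      ; _*_ = λ { (a , s) (b , u) → (a * b , s *D u) }
      ; -_  = λ { (a , s) → (- a , s) }
      ; 0#  = (0# , 1D)
      ; 1#  = (1# , 1D)
      }

    LCarrier : Set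
    LCarrier = Carrier × Den

    locModule : Module R 0ℓ 0ℓ → RawLeftModule LCarrier 0ℓ 0ℓ
    locModule M = record
      { Carrierᴹ = Carrierᴹ × Den
      ; _≈ᴹ_ = λ { (m , s) (n , u) → Σ[ v ∈ Den ] (((proj₁ v * proj₁ u) *ₗ m) ≈ᴹ ((proj₁ v * proj₁ s) *ₗ n)) }
      ; _+ᴹ_ = λ { (m , s) (n , u) → ((proj₁ u *ₗ m) +ᴹ (proj₁ s *ₗ n) , s *D u) }
      ; _*ₗ_ = λ { (a , w) (m , s) → (a *ₗ m , w *D s) }
      ; 0ᴹ   = (0ᴹ , 1D)
      ; -ᴹ_  = λ { (m , s) → (-ᴹ m , s) }
      }
      where open Module M

    locIdeal : Pred Carrier 0ℓ → Pred LCarrier 0ℓ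
    locIdeal I x = Σ[ a ∈ Carrier ] Σ[ ai ∈ I a ] Σ[ u ∈ Den ] RawRing._≈_ locRing x (a , u)

    locP : PMod Carrier → PMod LCarrier
    locP P = record
      { Elt  = P.Elt × Den
      ; Good = λ { (x , s) → P.Good x }
      ; _≈_  = λ { (x , s) (y , u) → Σ[ v ∈ Den ] (((proj₁ v * proj₁ u) P.· x) P.≈ ((proj₁ v * proj₁ s) P.· y)) }
      ; _+_  = λ { (x , s) (y , u) → ((proj₁ u P.· x) P.+ (proj₁ s P.· y) , s *D u) }
      ; 0e   = (P.0e , 1D)
      ; _·_  = λ { (a , w) (x , s) → (a P.· x , w *D s) }
      }
      where module P = PMod P

    H_loc : Module R 0ℓ 0ℓ → Pred Carrier 0ℓ → PMod LCarrier
    H_loc M I = HTheory.H locRing (locModule M) (locIdeal I)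

    locMap : (M : Module R 0ℓ 0ℓ) (I : Pred Carrier 0ℓ) →
             PMod.Elt (locP (H_R M I)) → PMod.Elt (H_loc M I)
    locMap M I (φ , s) x (a , ai , u , _) = (φ a ai , s *D u)

module _ {R : CommutativeRing 0ℓ 0ℓ} where
  open CommutativeRing R

  ΠM : (Λ : Set) → (Λ → Module R 0ℓ 0ℓ) → RawLeftModule Carrier 0ℓ 0ℓ
  ΠM Λ M = record
    { Carrierᴹ = (λ' : Λ) → Module.Carrierᴹ (M λ')
    ; _≈ᴹ_ = λ x y → (λ' : Λ) → Module._≈ᴹ_ (M λ') (x λ') (y λ')
    ; _+ᴹ_ = λ x y λ' → Module._+ᴹ_ (M λ') (x λ') (y λ')
    ; _*ₗ_ = λ a x λ' → Module._*ₗ_ (M λ') a (x λ')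
    ; 0ᴹ   = λ λ' → Module.0ᴹ (M λ')
    ; -ᴹ_  = λ x λ' → Module.-ᴹ_ (M λ') (x λ')
    }

  FinSuppM : (Λ : Set) (M : Λ → Module R 0ℓ 0ℓ) → RawLeftModule.Carrierᴹ (ΠM Λ M) → Set
  FinSuppM Λ M x = Σ[ L ∈ List Λ ] ((λ' : Λ) → λ' ∈ L ⊎ Module._≈ᴹ_ (M λ') (x λ') (Module.0ᴹ (M λ')))

  private
    supp+ : (Λ : Set) (M : Λ → Module R 0ℓ 0ℓ) (x y : RawLeftModule.Carrierᴹ (ΠM Λ M)) →
            FinSuppM Λ M x → FinSuppM Λ M y →
            FinSuppM Λ M (RawLeftModule._+ᴹ_ (ΠM Λ M) x y)
    supp+ Λ M x y (L , p) (K , q) = (L ++ K) , λ λ' → go λ' (p λ') (q λ')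
      where
      go : ∀ λ' → _ → _ → _
      go λ' (inj₁ i) _ = inj₁ (∈-++⁺ˡ i)
      go λ' (inj₂ _) (inj₁ j) = inj₁ (∈-++⁺ʳ L j)
      go λ' (inj₂ e) (inj₂ f) = inj₂ (let open Module (M λ') in
        ≈ᴹ-trans (+ᴹ-cong e f) (+ᴹ-identityˡ 0ᴹ))

    supp- : (Λ : Set) (M : Λ → Module R 0ℓ 0ℓ) (x : RawLeftModule.Carrierᴹ (ΠM Λ M)) →
            FinSuppM Λ M x → FinSuppM Λ M (RawLeftModule.-ᴹ_ (ΠM Λ M) x)
    supp- Λ M x (L , p) = L , λ λ' → Data.Sum.map₂ (λ e → let open Module (M λ') in
      ≈ᴹ-trans (-ᴹ‿cong e) (AbGroupProps.ε⁻¹≈ε +ᴹ-abelianGroup)) (p λ')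

    supp* : (Λ : Set) (M : Λ → Module R 0ℓ 0ℓ) (a : Carrier) (x : RawLeftModule.Carrierᴹ (ΠM Λ M)) →
            FinSuppM Λ M x → FinSuppM Λ M (RawLeftModule._*ₗ_ (ΠM Λ M) a x)
    supp* Λ M a x (L , p) = L , λ λ' → Data.Sum.map₂ (λ e → let open Module (M λ') in
      ≈ᴹ-trans (*ₗ-congˡ e) (*ₗ-zeroʳ a)) (p λ')

  ⊕M : (Λ : Set) → (Λ → Module R 0ℓ 0ℓ) → RawLeftModule Carrier 0ℓ 0ℓ
  ⊕M Λ M = record
    { Carrierᴹ = Σ[ x ∈ Π.Carrierᴹ ] FinSuppM Λ M x
    ; _≈ᴹ_ = λ x y → proj₁ x Π.≈ᴹ proj₁ y
    ; _+ᴹ_ = λ x y → (proj₁ x Π.+ᴹ proj₁ y) , supp+ Λ M (proj₁ x) (proj₁ y) (proj₂ x) (proj₂ y)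
    ; _*ₗ_ = λ a x → (a Π.*ₗ proj₁ x) , supp* Λ M a (proj₁ x) (proj₂ x)
    ; 0ᴹ   = Π.0ᴹ , [] , λ λ' → inj₂ (Module.≈ᴹ-refl (M λ'))
    ; -ᴹ_  = λ x → (Π.-ᴹ proj₁ x) , supp- Λ M (proj₁ x) (proj₂ x)
    }
    where module Π = RawLeftModule (ΠM Λ M)

  H_Π : (Λ : Set) → (Λ → Module R 0ℓ 0ℓ) → Pred Carrier 0ℓ → PMod Carrier
  H_Π Λ M I = HTheory.H rawRing (ΠM Λ M) I

  H_⊕ : (Λ : Set) → (Λ → Module R 0ℓ 0ℓ) → Pred Carrier 0ℓ → PMod Carrier
  H_⊕ Λ M I = HTheory.H rawRing (⊕M Λ M) I

  mapΠ : (Λ : Set) (M : Λ → Module R 0ℓ 0ℓ) (I : Pred Carrier 0ℓ) →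
         PMod.Elt (H_Π Λ M I) → PMod.Elt (ΠP Λ (λ λ' → H_R R (M λ') I))
  mapΠ Λ M I φ λ' t p = φ t p λ'

  map⊕ : (Λ : Set) (M : Λ → Module R 0ℓ 0ℓ) (I : Pred Carrier 0ℓ) →
         PMod.Elt (H_⊕ Λ M I) → PMod.Elt (⊕P Λ (λ λ' → H_R R (M λ') I))
  map⊕ Λ M I φ λ' t p = proj₁ (φ t p) λ'

module Submission where

-- Every H is presented by its representatives Z with the relation "the
-- difference is principal", so each statement is a list of facts about
-- representatives.  Then:
--   (1) Products: everything is componentwise.
--   (2) Direct sums: through ⊕ ⊆ ∏; supports stay finite because a map is
--       controlled by its values on the finitely many generators.
--   (3) Restriction from I + ann(M): Z-maps are constant modulo ann(M).
--   (4) Localisation: the natural map is linear; injectivity clears the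
--       finitely many denominators coming from the generators.

open import Defs
open import Level using (0ℓ)
open import Algebra.Bundles using (CommutativeRing; AbelianGroup; RawRing)
open import Algebra.Module.Bundles using (Module)
open import Algebra.Module.Bundles.Raw using (RawLeftModule)
open import Relation.Unary using (Pred)
open import Data.Product using (Σ; _×_; _,_; proj₁; proj₂)
open import Data.Sum using (_⊎_; inj₁; inj₂)
open import Data.Nat using (ℕ; zero; suc)
open import Data.Fin using (Fin; zero; suc)
open import Data.List using (List; _++_; concat; tabulate)
open import Data.List.Membership.Propositional using (_∈_)
open import Data.List.Membership.Propositional.Properties using (∈-++⁺ˡ; ∈-++⁺ʳ)
import Algebra.Properties.AbelianGroup as AbelianGroupProperties
import Algebra.Properties.CommutativeSemigroup as CommutativeSemigroupProperties
import Algebra.Properties.Ring as RingProperties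
import Relation.Binary.Reasoning.Setoid as SetoidReasoning

module SubtractionFacts (G : AbelianGroup 0ℓ 0ℓ) where
  open AbelianGroup G
  open AbelianGroupProperties G
  open CommutativeSemigroupProperties commutativeSemigroup using (interchange)
  open SetoidReasoning setoid

  sub-distrib-∙ : ∀ x y a b → (x ∙ y) ∙ (a ∙ b) ⁻¹ ≈ (x ∙ a ⁻¹) ∙ (y ∙ b ⁻¹)
  sub-distrib-∙ x y a b = begin
    (x ∙ y) ∙ (a ∙ b) ⁻¹    ≈⟨ ∙-congˡ (⁻¹-∙-comm a b) ⟨
    (x ∙ y) ∙ (a ⁻¹ ∙ b ⁻¹) ≈⟨ interchange x y (a ⁻¹) (b ⁻¹) ⟩
    (x ∙ a ⁻¹) ∙ (y ∙ b ⁻¹) ∎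

  sub-telescope : ∀ x y z → (x ∙ y ⁻¹) ∙ (y ∙ z ⁻¹) ≈ x ∙ z ⁻¹
  sub-telescope x y z = begin
    (x ∙ y ⁻¹) ∙ (y ∙ z ⁻¹) ≈⟨ assoc x (y ⁻¹) (y ∙ z ⁻¹) ⟩
    x ∙ (y ⁻¹ ∙ (y ∙ z ⁻¹)) ≈⟨ ∙-congˡ (assoc (y ⁻¹) y (z ⁻¹)) ⟨
    x ∙ ((y ⁻¹ ∙ y) ∙ z ⁻¹) ≈⟨ ∙-congˡ (∙-congʳ (inverseˡ y)) ⟩
    x ∙ (ε ∙ z ⁻¹)          ≈⟨ ∙-congˡ (identityˡ _) ⟩
    x ∙ z ⁻¹                ∎

  sub-of-sum : ∀ {x y z} → x ≈ y ∙ z → x ∙ y ⁻¹ ≈ z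
  sub-of-sum {x} {y} {z} e = begin
    x ∙ y ⁻¹       ≈⟨ ∙-congʳ e ⟩
    (y ∙ z) ∙ y ⁻¹ ≈⟨ ∙-congʳ (comm y z) ⟩
    (z ∙ y) ∙ y ⁻¹ ≈⟨ //-rightDividesʳ y z ⟩
    z              ∎

  sub-ε : ∀ x → x ∙ ε ⁻¹ ≈ x
  sub-ε x = trans (∙-congˡ ε⁻¹≈ε) (identityʳ x)

module ScalarFacts {R : CommutativeRing 0ℓ 0ℓ} (M : Module R 0ℓ 0ℓ) where
  open CommutativeRing R
  open Module M
  open AbelianGroupProperties +ᴹ-abelianGroup using (inverseʳ-unique)
  open SetoidReasoning ≈ᴹ-setoid

  *ₗ-neg : ∀ a m → (a *ₗ (-ᴹ m)) ≈ᴹ (-ᴹ (a *ₗ m))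
  *ₗ-neg a m = inverseʳ-unique (a *ₗ m) (a *ₗ (-ᴹ m)) (begin
    (a *ₗ m) +ᴹ (a *ₗ (-ᴹ m)) ≈⟨ *ₗ-distribˡ a m (-ᴹ m) ⟨
    a *ₗ (m +ᴹ (-ᴹ m))        ≈⟨ *ₗ-congˡ (-ᴹ‿inverseʳ m) ⟩
    a *ₗ 0ᴹ                   ≈⟨ *ₗ-zeroʳ a ⟩
    0ᴹ                        ∎)

  *ₗ-sub : ∀ a m n → (a *ₗ (m +ᴹ (-ᴹ n))) ≈ᴹ ((a *ₗ m) +ᴹ (-ᴹ (a *ₗ n)))
  *ₗ-sub a m n = ≈ᴹ-trans (*ₗ-distribˡ a m (-ᴹ n)) (+ᴹ-congˡ (*ₗ-neg a n))

  *ₗ-combination : ∀ c α β X Y →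
                   (c *ₗ ((α *ₗ X) +ᴹ (β *ₗ Y))) ≈ᴹ (((c * α) *ₗ X) +ᴹ ((c * β) *ₗ Y))
  *ₗ-combination c α β X Y =
    ≈ᴹ-trans (*ₗ-distribˡ c _ _) (+ᴹ-cong (≈ᴹ-sym (*ₗ-assoc c α X)) (≈ᴹ-sym (*ₗ-assoc c β Y)))

∈-concat-or-all : ∀ {A : Set} {l : A} n (f : Fin n → List A) (Z : Fin n → Set) →
                  (∀ i → l ∈ f i ⊎ Z i) → l ∈ concat (tabulate f) ⊎ (∀ i → Z i)
∈-concat-or-all zero    f Z h = inj₂ (λ ())
∈-concat-or-all (suc n) f Z h with h zero
... | inj₁ l∈f₀ = inj₁ (∈-++⁺ˡ l∈f₀)
... | inj₂ z₀ with ∈-concat-or-all n (λ i → f (suc i)) (λ i → Z (suc i)) (λ i → h (suc i))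
...   | inj₁ l∈rest = inj₁ (∈-++⁺ʳ (f zero) l∈rest)
...   | inj₂ zs     = inj₂ λ { zero → z₀ ; (suc i) → zs i }

∈-++-or-both : ∀ {A : Set} {l : A} {X Y : List A} {Z₁ Z₂ : Set} →
               l ∈ X ⊎ Z₁ → l ∈ Y ⊎ Z₂ → l ∈ X ++ Y ⊎ (Z₁ × Z₂)
∈-++-or-both (inj₁ l∈X) _ = inj₁ (∈-++⁺ˡ l∈X)
∈-++-or-both {X = X} (inj₂ _) (inj₁ l∈Y) = inj₁ (∈-++⁺ʳ X l∈Y)
∈-++-or-both (inj₂ z₁) (inj₂ z₂) = inj₂ (z₁ , z₂)

module Generators (R : CommutativeRing 0ℓ 0ℓ) {I : Pred (CommutativeRing.Carrier R) 0ℓ}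
                  (fg : FinGen R I) where
  open CommutativeRing R

  #gen : ℕ
  #gen = proj₁ fg

  gen : Fin #gen → Carrier
  gen = proj₁ (proj₂ fg)

  gen∈I : ∀ i → I (gen i)
  gen∈I = proj₁ (proj₂ (proj₂ fg))

module HomFacts (R : CommutativeRing 0ℓ 0ℓ) (I : Pred (CommutativeRing.Carrier R) 0ℓ)
                (N : Module R 0ℓ 0ℓ) where
  open CommutativeRing R hiding (zero)
  open Module N
  open AbelianGroupProperties +ᴹ-abelianGroup using (x≈y⇒x∙y⁻¹≈ε; //-rightDividesʳ)
  open SubtractionFacts +ᴹ-abelianGroup
  open ScalarFacts N
  module H = HTheory rawRing rawLeftModule I
  open H using (Fn; IsHom; _∼_; _⊕_; ⊖_; _∙_)
  open SetoidReasoning ≈ᴹ-setoid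

  pointwise⇒∼ : ∀ {f g : Fn} → (∀ t p → f t p ≈ᴹ g t p) → f ∼ g
  pointwise⇒∼ e = 0ᴹ , λ t p → ≈ᴹ-trans (x≈y⇒x∙y⁻¹≈ε (e t p)) (≈ᴹ-sym (*ₗ-zeroʳ t))

  ⊖-hom : ∀ {f g} → IsHom f → IsHom g → IsHom (f ⊕ (⊖ g))
  ⊖-hom hf hg = record
    { cong        = λ p q e → +ᴹ-cong (IsHom.cong hf p q e) (-ᴹ‿cong (IsHom.cong hg p q e))
    ; additive    = λ p q r → ≈ᴹ-trans (+ᴹ-cong (IsHom.additive hf p q r) (-ᴹ‿cong (IsHom.additive hg p q r)))
                                       (sub-distrib-∙ _ _ _ _)
    ; homogeneous = λ a p q → ≈ᴹ-trans (+ᴹ-cong (IsHom.homogeneous hf a p q) (-ᴹ‿cong (IsHom.homogeneous hg a p q)))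
                                       (≈ᴹ-sym (*ₗ-sub a _ _))
    }

  ∙-hom : ∀ c {f} → IsHom f → IsHom (c ∙ f)
  ∙-hom c hf = record
    { cong        = λ p q e → *ₗ-congˡ (IsHom.cong hf p q e)
    ; additive    = λ p q r → ≈ᴹ-trans (*ₗ-congˡ (IsHom.additive hf p q r)) (*ₗ-distribˡ c _ _)
    ; homogeneous = λ a p q → ≈ᴹ-trans (*ₗ-congˡ (IsHom.homogeneous hf a p q))
        (≈ᴹ-trans (≈ᴹ-sym (*ₗ-assoc c a _)) (≈ᴹ-trans (*ₗ-congʳ (*-comm c a)) (*ₗ-assoc a c _)))
    }

  _−ₚ_ : Fn → Carrierᴹ → Fn
  (f −ₚ m) t p = f t p +ᴹ (-ᴹ (t *ₗ m))

  −ₚ-hom : ∀ {f} m → IsHom f → IsHom (f −ₚ m)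
  −ₚ-hom m hf = record
    { cong        = λ p q e → +ᴹ-cong (IsHom.cong hf p q e) (-ᴹ‿cong (*ₗ-congʳ e))
    ; additive    = λ p q r → ≈ᴹ-trans (+ᴹ-cong (IsHom.additive hf p q r) (-ᴹ‿cong (*ₗ-distribʳ m _ _)))
                                       (sub-distrib-∙ _ _ _ _)
    ; homogeneous = λ a p q → ≈ᴹ-trans (+ᴹ-cong (IsHom.homogeneous hf a p q) (-ᴹ‿cong (*ₗ-assoc a _ m)))
                                       (≈ᴹ-sym (*ₗ-sub a _ _))
    }

  −ₚ-∼ : ∀ f m → (f −ₚ m) ∼ f
  −ₚ-∼ f m = -ᴹ m , λ t p → begin
    (f t p +ᴹ (-ᴹ (t *ₗ m))) +ᴹ (-ᴹ f t p) ≈⟨ +ᴹ-congʳ (+ᴹ-comm _ _) ⟩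
    ((-ᴹ (t *ₗ m)) +ᴹ f t p) +ᴹ (-ᴹ f t p) ≈⟨ //-rightDividesʳ (f t p) _ ⟩
    -ᴹ (t *ₗ m)                            ≈⟨ *ₗ-neg t m ⟨
    t *ₗ (-ᴹ m)                            ∎

  −ₚ-vanishes : ∀ f m → (∀ t p → (f t p +ᴹ (-ᴹ 0ᴹ)) ≈ᴹ (t *ₗ m)) → ∀ t p → (f −ₚ m) t p ≈ᴹ 0ᴹ
  −ₚ-vanishes f m e t p = x≈y⇒x∙y⁻¹≈ε (≈ᴹ-trans (≈ᴹ-sym (sub-ε _)) (e t p))

  module FinitelyGenerated (isI : IsIdeal R I) (fg : FinGen R I) where
    open IsIdeal isI
    open Generators R fg

    combination∈I : ∀ n (c g : Fin n → Carrier) → (∀ i → I (g i)) → I (sumFin R n (λ i → c i * g i))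
    combination∈I zero    c g g∈I = zero∈
    combination∈I (suc n) c g g∈I = +∈ (*∈ (c zero) (g∈I zero))
      (combination∈I n (λ i → c (suc i)) (λ i → g (suc i)) (λ i → g∈I (suc i)))

    module _ (δ : Fn) (hδ : IsHom δ) (m : Carrierᴹ) where
      principal-at-0 : (q : I 0#) → δ 0# q ≈ᴹ (0# *ₗ m)
      principal-at-0 q = begin
        δ 0# q                   ≈⟨ IsHom.cong hδ q (*∈ 0# q) (sym (zeroˡ 0#)) ⟩
        δ (0# * 0#) (*∈ 0# q)    ≈⟨ IsHom.homogeneous hδ 0# q _ ⟩
        0# *ₗ δ 0# q             ≈⟨ *ₗ-zeroˡ _ ⟩
        0ᴹ                       ≈⟨ *ₗ-zeroˡ m ⟨
        0# *ₗ m                  ∎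

      principal-on-combination : ∀ n (c g : Fin n → Carrier) (g∈I : ∀ i → I (g i)) →
        (∀ i → δ (g i) (g∈I i) ≈ᴹ (g i *ₗ m)) →
        (q : I (sumFin R n (λ i → c i * g i))) → δ _ q ≈ᴹ (sumFin R n (λ i → c i * g i) *ₗ m)
      principal-on-combination zero    c g g∈I hg q = principal-at-0 q
      principal-on-combination (suc n) c g g∈I hg q = begin
        δ (c₀g₀ + rest) q                        ≈⟨ IsHom.additive hδ p₀ p-rest q ⟩
        δ c₀g₀ p₀ +ᴹ δ rest p-rest               ≈⟨ +ᴹ-cong (IsHom.homogeneous hδ (c zero) (g∈I zero) p₀)
          (principal-on-combination n (λ i → c (suc i)) (λ i → g (suc i)) (λ i → g∈I (suc i))
                                      (λ i → hg (suc i)) p-rest) ⟩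
        (c zero *ₗ δ (g zero) (g∈I zero)) +ᴹ (rest *ₗ m) ≈⟨ +ᴹ-congʳ (*ₗ-congˡ (hg zero)) ⟩
        (c zero *ₗ (g zero *ₗ m)) +ᴹ (rest *ₗ m) ≈⟨ +ᴹ-congʳ (*ₗ-assoc (c zero) (g zero) m) ⟨
        (c₀g₀ *ₗ m) +ᴹ (rest *ₗ m)               ≈⟨ *ₗ-distribʳ m _ _ ⟨
        (c₀g₀ + rest) *ₗ m                       ∎
        where
        c₀g₀ = c zero * g zero
        rest = sumFin R n (λ i → c (suc i) * g (suc i))
        p₀ = *∈ (c zero) (g∈I zero)
        p-rest = combination∈I n (λ i → c (suc i)) (λ i → g (suc i)) (λ i → g∈I (suc i))

    principal-on-generators : ∀ (δ : Fn) → IsHom δ → ∀ m →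
      (∀ i → δ (gen i) (gen∈I i) ≈ᴹ (gen i *ₗ m)) → ∀ t (p : I t) → δ t p ≈ᴹ (t *ₗ m)
    principal-on-generators δ hδ m hg t p = begin
      δ t p     ≈⟨ IsHom.cong hδ p q t≈Σ ⟩
      δ _ q     ≈⟨ principal-on-combination δ hδ m #gen c gen gen∈I hg q ⟩
      _ *ₗ m    ≈⟨ *ₗ-congʳ (sym t≈Σ) ⟩
      t *ₗ m    ∎
      where
      c = proj₁ (proj₂ (proj₂ (proj₂ fg)) t p)
      t≈Σ = proj₂ (proj₂ (proj₂ (proj₂ fg)) t p)
      q = combination∈I #gen c gen gen∈I

    vanishing-on-generators : ∀ (δ : Fn) → IsHom δ →
      (∀ i → δ (gen i) (gen∈I i) ≈ᴹ 0ᴹ) → ∀ t (p : I t) → δ t p ≈ᴹ (t *ₗ 0ᴹ)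
    vanishing-on-generators δ hδ hg = principal-on-generators δ hδ 0ᴹ
      (λ i → ≈ᴹ-trans (hg i) (≈ᴹ-sym (*ₗ-zeroʳ (gen i))))

module Products (R : CommutativeRing 0ℓ 0ℓ) (I : Pred (CommutativeRing.Carrier R) 0ℓ)
                (Λ : Set) (Ms : Λ → Module R 0ℓ 0ℓ) where
  open CommutativeRing R
  module HΠ = HTheory rawRing (ΠM Λ Ms) I
  module Hλ (l : Λ) = HTheory rawRing (Module.rawLeftModule (Ms l)) I
  module Fλ (l : Λ) = HomFacts R I (Ms l)

  component : HΠ.Fn → (l : Λ) → Hλ.Fn l
  component φ l t p = φ t p l

  tuple : ((l : Λ) → Hλ.Fn l) → HΠ.Fn
  tuple ψ t p l = ψ l t p

  component-hom : ∀ {φ} → HΠ.IsHom φ → ∀ l → Hλ.IsHom l (component φ l)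
  component-hom h l = record
    { cong        = λ p q e → HΠ.IsHom.cong h p q e l
    ; additive    = λ p q r → HΠ.IsHom.additive h p q r l
    ; homogeneous = λ a p q → HΠ.IsHom.homogeneous h a p q l
    }

  component-Z : ∀ {φ} → HΠ.IsZ φ → ∀ l → Hλ.IsZ l (component φ l)
  component-Z (h , loc) l = component-hom h l , λ t p → proj₁ (loc t p) l , proj₂ (loc t p) l

  tuple-hom : ∀ {ψ} → (∀ l → Hλ.IsHom l (ψ l)) → HΠ.IsHom (tuple ψ)
  tuple-hom h = record
    { cong        = λ p q e l → Hλ.IsHom.cong (h l) p q e
    ; additive    = λ p q r l → Hλ.IsHom.additive (h l) p q r
    ; homogeneous = λ a p q l → Hλ.IsHom.homogeneous (h l) a p q
    }

  tuple-Z : ∀ {ψ} → (∀ l → Hλ.IsZ l (ψ l)) → HΠ.IsZ (tuple ψ)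
  tuple-Z z = tuple-hom (λ l → proj₁ (z l))
            , λ t p → (λ l → proj₁ (proj₂ (z l) t p)) , λ l → proj₂ (proj₂ (z l) t p)

  iso : IsIso (H_Π Λ Ms I) (ΠP Λ (λ l → H_R R (Ms l) I)) (mapΠ Λ Ms I)
  iso = record
    { good = λ φ z → component-Z z
    ; resp = λ φ ψ _ _ (m , e) l → m l , λ t p → e t p l
    ; add  = λ φ ψ _ _ l → Fλ.pointwise⇒∼ l (λ t p → Module.≈ᴹ-refl (Ms l))
    ; hom  = λ a φ _ l → Fλ.pointwise⇒∼ l (λ t p → Module.≈ᴹ-refl (Ms l))
    ; inj  = λ φ ψ _ _ e → (λ l → proj₁ (e l)) , λ t p l → proj₂ (e l) t p
    ; surj = λ ψ z → tuple ψ , tuple-Z z , λ l → Fλ.pointwise⇒∼ l (λ t p → Module.≈ᴹ-refl (Ms l))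
    }

-- The inclusion ⊕ M_λ ⊆ ∏ M_λ reduces homomorphisms to
-- the product case; the finiteness of supports is where finite generation
-- of I enters: φ(t) for t = Σ cᵢ gᵢ is supported on the union of the
-- supports of the finitely many φ(gᵢ).
module DirectSums (R : CommutativeRing 0ℓ 0ℓ) (I : Pred (CommutativeRing.Carrier R) 0ℓ)
                  (isI : IsIdeal R I) (Λ : Set) (Ms : Λ → Module R 0ℓ 0ℓ) (fg : FinGen R I) where
  open CommutativeRing R hiding (zero)
  open Products R I Λ Ms hiding (iso)
  open Generators R fg
  module H⊕ = HTheory rawRing (⊕M Λ Ms) I
  module Gλ (l : Λ) = HomFacts.FinitelyGenerated R I (Ms l) isI fg
  module Mλ (l : Λ) = Module (Ms l)
  module Aλ (l : Λ) = SubtractionFacts (Mλ.+ᴹ-abelianGroup l)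

  forget : H⊕.Fn → HΠ.Fn
  forget φ t p = proj₁ (φ t p)

  forget-hom : ∀ {φ} → H⊕.IsHom φ → HΠ.IsHom (forget φ)
  forget-hom h = record
    { cong = H⊕.IsHom.cong h ; additive = H⊕.IsHom.additive h ; homogeneous = H⊕.IsHom.homogeneous h }

  forget-hom⁻¹ : ∀ {φ} → HΠ.IsHom (forget φ) → H⊕.IsHom φ
  forget-hom⁻¹ h = record
    { cong = HΠ.IsHom.cong h ; additive = HΠ.IsHom.additive h ; homogeneous = HΠ.IsHom.homogeneous h }

  support : H⊕.Fn → List Λ
  support φ = concat (tabulate (λ i → proj₁ (proj₂ (φ (gen i) (gen∈I i)))))

  support-covers : ∀ φ → H⊕.IsHom φ → ∀ l →
                   l ∈ support φ ⊎ Hλ._∼_ l (component (forget φ) l) (Hλ.0F l)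
  support-covers φ h l
    with ∈-concat-or-all #gen _ _ (λ i → proj₂ (proj₂ (φ (gen i) (gen∈I i))) l)
  ... | inj₁ l∈supp = inj₁ l∈supp
  ... | inj₂ zero-on-gens = inj₂ (Mλ.0ᴹ l , λ t p → Mλ.≈ᴹ-trans l (Aλ.sub-ε l _)
          (Gλ.vanishing-on-generators l _ (component-hom (forget-hom h) l) zero-on-gens t p))

  good : ∀ φ → H⊕.IsZ φ → PMod.Good (⊕P Λ (λ l → H_R R (Ms l) I)) (map⊕ Λ Ms I φ)
  good φ (h , loc) = component-Z (forget-hom h , λ t p → proj₁ (proj₁ (loc t p)) , proj₂ (loc t p))
                   , support φ , support-covers φ h

  -- If the components of φ and ψ are equivalent, choose the witnesses on the
  -- joint support and 0 elsewhere; off the support φ - ψ vanishes on generators.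
  injective : ∀ φ ψ → H⊕.IsZ φ → H⊕.IsZ ψ →
              PMod._≈_ (⊕P Λ (λ l → H_R R (Ms l) I)) (map⊕ Λ Ms I φ) (map⊕ Λ Ms I ψ) → φ H⊕.∼ ψ
  injective φ ψ (hφ , _) (hψ , _) same = (witness , joint , λ l → witness-supported l (split l))
                                        , λ t p l → witness-works l (split l) t p
    where
    supports : Fin #gen → List Λ
    supports i = proj₁ (proj₂ (φ (gen i) (gen∈I i))) ++ proj₁ (proj₂ (ψ (gen i) (gen∈I i)))
    joint : List Λ
    joint = concat (tabulate supports)
    Off : Λ → Set
    Off l = (i : Fin #gen) → Mλ._≈ᴹ_ l (proj₁ (φ (gen i) (gen∈I i)) l) (Mλ.0ᴹ l)
                           × Mλ._≈ᴹ_ l (proj₁ (ψ (gen i) (gen∈I i)) l) (Mλ.0ᴹ l)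
    split : ∀ l → l ∈ joint ⊎ Off l
    split l = ∈-concat-or-all #gen supports _
      (λ i → ∈-++-or-both (proj₂ (proj₂ (φ (gen i) (gen∈I i))) l) (proj₂ (proj₂ (ψ (gen i) (gen∈I i))) l))
    choose : ∀ l → l ∈ joint ⊎ Off l → Mλ.Carrierᴹ l
    choose l (inj₁ _) = proj₁ (same l)
    choose l (inj₂ _) = Mλ.0ᴹ l
    witness : (l : Λ) → Mλ.Carrierᴹ l
    witness l = choose l (split l)
    witness-supported : ∀ l (d : l ∈ joint ⊎ Off l) → l ∈ joint ⊎ Mλ._≈ᴹ_ l (choose l d) (Mλ.0ᴹ l)
    witness-supported l (inj₁ l∈joint) = inj₁ l∈joint
    witness-supported l (inj₂ _)       = inj₂ (Mλ.≈ᴹ-refl l)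
    witness-works : ∀ l (d : l ∈ joint ⊎ Off l) t (p : I t) →
      Mλ._≈ᴹ_ l (Mλ._+ᴹ_ l (proj₁ (φ t p) l) (Mλ.-ᴹ_ l (proj₁ (ψ t p) l))) (Mλ._*ₗ_ l t (choose l d))
    witness-works l (inj₁ _)  t p = proj₂ (same l) t p
    witness-works l (inj₂ zs) t p = Gλ.vanishing-on-generators l _
        (HomFacts.⊖-hom R I (Ms l) (component-hom (forget-hom hφ) l) (component-hom (forget-hom hψ) l))
        (λ i → ≈ᴹ-trans (+ᴹ-cong (proj₁ (zs i)) (-ᴹ‿cong (proj₂ (zs i)))) (-ᴹ‿inverseʳ 0ᴹ)) t p
      where open Module (Ms l)

  -- Given a finitely supported family of classes, pick representatives that
  -- are identically zero off the support: at l ∉ L, replace y_l by y_l −ₚ m_l.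
  surjective : ∀ y → PMod.Good (⊕P Λ (λ l → H_R R (Ms l) I)) y →
               Σ H⊕.Fn (λ φ → H⊕.IsZ φ × PMod._≈_ (⊕P Λ (λ l → H_R R (Ms l) I)) (map⊕ Λ Ms I φ) y)
  surjective y (z , L , covers) = φ , (φ-hom , φ-local) , λ l → rep-∼ l (covers l)
    where
    Alt : Λ → Set
    Alt l = l ∈ L ⊎ Hλ._∼_ l (y l) (Hλ.0F l)
    rep : ∀ l → Alt l → Hλ.Fn l
    rep l (inj₁ _)       = y l
    rep l (inj₂ (m , _)) = Fλ._−ₚ_ l (y l) m
    rep-hom : ∀ l (d : Alt l) → Hλ.IsHom l (rep l d)
    rep-hom l (inj₁ _)       = proj₁ (z l)
    rep-hom l (inj₂ (m , _)) = Fλ.−ₚ-hom l m (proj₁ (z l))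
    rep-∼ : ∀ l (d : Alt l) → Hλ._∼_ l (rep l d) (y l)
    rep-∼ l (inj₁ _)       = Fλ.pointwise⇒∼ l (λ t p → Mλ.≈ᴹ-refl l)
    rep-∼ l (inj₂ (m , _)) = Fλ.−ₚ-∼ l (y l) m
    rep-supported : ∀ l (d : Alt l) t (p : I t) → l ∈ L ⊎ Mλ._≈ᴹ_ l (rep l d t p) (Mλ.0ᴹ l)
    rep-supported l (inj₁ l∈L)     t p = inj₁ l∈L
    rep-supported l (inj₂ (m , e)) t p = inj₂ (Fλ.−ₚ-vanishes l (y l) m e t p)
    local-witness : ∀ l → Alt l → (t : Carrier) → I t → Mλ.Carrierᴹ l
    local-witness l (inj₁ _) t p = proj₁ (proj₂ (z l) t p)
    local-witness l (inj₂ _) t p = Mλ.0ᴹ l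
    local-witness-works : ∀ l (d : Alt l) t (p : I t) →
                          Mλ._≈ᴹ_ l (rep l d t p) (Mλ._*ₗ_ l t (local-witness l d t p))
    local-witness-works l (inj₁ _)       t p = proj₂ (proj₂ (z l) t p)
    local-witness-works l (inj₂ (m , e)) t p =
      Mλ.≈ᴹ-trans l (Fλ.−ₚ-vanishes l (y l) m e t p) (Mλ.≈ᴹ-sym l (Mλ.*ₗ-zeroʳ l t))
    local-witness-supported : ∀ l (d : Alt l) t (p : I t) →
                              l ∈ L ⊎ Mλ._≈ᴹ_ l (local-witness l d t p) (Mλ.0ᴹ l)
    local-witness-supported l (inj₁ l∈L) t p = inj₁ l∈L
    local-witness-supported l (inj₂ _)   t p = inj₂ (Mλ.≈ᴹ-refl l)
    φ : H⊕.Fn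
    φ t p = (λ l → rep l (covers l) t p) , L , λ l → rep-supported l (covers l) t p
    φ-hom : H⊕.IsHom φ
    φ-hom = forget-hom⁻¹ (tuple-hom (λ l → rep-hom l (covers l)))
    φ-local : H⊕.IsLocal φ
    φ-local t p = ((λ l → local-witness l (covers l) t p) , L , λ l → local-witness-supported l (covers l) t p)
                , λ l → local-witness-works l (covers l) t p

  iso : IsIso (H_⊕ Λ Ms I) (⊕P Λ (λ l → H_R R (Ms l) I)) (map⊕ Λ Ms I)
  iso = record
    { good = good
    ; resp = λ φ ψ _ _ ((m , _) , e) l → m l , λ t p → e t p l
    ; add  = λ φ ψ _ _ l → Fλ.pointwise⇒∼ l (λ t p → Mλ.≈ᴹ-refl l)
    ; hom  = λ a φ _ l → Fλ.pointwise⇒∼ l (λ t p → Mλ.≈ᴹ-refl l)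
    ; inj  = injective
    ; surj = surjective
    }

module Congruence (R : CommutativeRing 0ℓ 0ℓ) {J : Pred (CommutativeRing.Carrier R) 0ℓ}
                  (isJ : IsIdeal R J) where
  open CommutativeRing R
  open IsIdeal isJ
  open RingProperties ring using (-1*x≈-x; x[y-z]≈xy-xz)
  open AbelianGroupProperties +-abelianGroup using (x≈y⇒x∙y⁻¹≈ε; ⁻¹-anti-homo‿-)
  open SubtractionFacts +-abelianGroup

  -∈ : ∀ {x} → J x → J (- x)
  -∈ {x} x∈J = resp (-1*x≈-x x) (*∈ (- 1#) x∈J)

  infix 4 _≡_mod
  _≡_mod : Carrier → Carrier → Set
  x ≡ y mod = J (x - y)

  ≈⇒≡ : ∀ {x y} → x ≈ y → x ≡ y mod
  ≈⇒≡ e = resp (sym (x≈y⇒x∙y⁻¹≈ε e)) zero∈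

  ≡-sym : ∀ {x y} → x ≡ y mod → y ≡ x mod
  ≡-sym {x} {y} j = resp (⁻¹-anti-homo‿- x y) (-∈ j)

  ≡-trans : ∀ {x y z} → x ≡ y mod → y ≡ z mod → x ≡ z mod
  ≡-trans {x} {y} {z} j k = resp (sub-telescope x y z) (+∈ j k)

  ≡-+ : ∀ {x y a b} → x ≡ a mod → y ≡ b mod → (x + y) ≡ (a + b) mod
  ≡-+ {x} {y} {a} {b} j k = resp (sym (sub-distrib-∙ x y a b)) (+∈ j k)

  ≡-* : ∀ r {x y} → x ≡ y mod → (r * x) ≡ (r * y) mod
  ≡-* r {x} {y} j = resp (x[y-z]≈xy-xz r x y) (*∈ r j)

  ≡-summand : ∀ {x a b} → x ≈ a + b → J b → x ≡ a mod
  ≡-summand e b∈J = resp (sym (sub-of-sum e)) b∈J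

module Annihilator (R : CommutativeRing 0ℓ 0ℓ) (M : Module R 0ℓ 0ℓ) where
  open CommutativeRing R
  open Module M

  ann-ideal : IsIdeal R (ann R M)
  ann-ideal = record
    { resp  = λ e j m → ≈ᴹ-trans (*ₗ-congʳ (sym e)) (j m)
    ; zero∈ = *ₗ-zeroˡ
    ; +∈    = λ {x} {y} jx jy m →
        ≈ᴹ-trans (*ₗ-distribʳ m x y) (≈ᴹ-trans (+ᴹ-cong (jx m) (jy m)) (+ᴹ-identityˡ 0ᴹ))
    ; *∈    = λ r {x} jx m → ≈ᴹ-trans (*ₗ-assoc r x m) (≈ᴹ-trans (*ₗ-congˡ (jx m)) (*ₗ-zeroʳ r))
    }

  open Congruence R ann-ideal public
  open AbelianGroupProperties +-abelianGroup using (//-rightDividesˡ)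

  ≡⇒same-action : ∀ {x a} → x ≡ a mod → ∀ m → (x *ₗ m) ≈ᴹ (a *ₗ m)
  ≡⇒same-action {x} {a} j m = begin
    x *ₗ m                          ≈⟨ *ₗ-congʳ (//-rightDividesˡ a x) ⟨
    ((x - a) + a) *ₗ m              ≈⟨ *ₗ-distribʳ m (x - a) a ⟩
    ((x - a) *ₗ m) +ᴹ (a *ₗ m)      ≈⟨ +ᴹ-congʳ (j m) ⟩
    0ᴹ +ᴹ (a *ₗ m)                  ≈⟨ +ᴹ-identityˡ _ ⟩
    a *ₗ m                          ∎
    where open SetoidReasoning ≈ᴹ-setoid

-- The key point is that every φ ∈ Z_R(I, M) is constant on
-- classes mod J: φ(a) - φ(a') = φ(a - a') = (a - a') n = 0.  Hence φ extends
-- to I + J by φ(a + b) := φ(a), and this extension is the inverse.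
module Restriction (R : CommutativeRing 0ℓ 0ℓ) (I : Pred (CommutativeRing.Carrier R) 0ℓ)
                   (isI : IsIdeal R I) (M : Module R 0ℓ 0ℓ) where
  open CommutativeRing R
  open Module M
  open Annihilator R M
  open HomFacts R I M using (pointwise⇒∼)
  module CI = Congruence R isI
  module II = IsIdeal isI
  open AbelianGroupProperties +-abelianGroup using (//-rightDividesˡ)
  J : Pred Carrier 0ℓ
  J = ann R M
  module HQ = HTheory (quotRing R J) rawLeftModule (_+ᴵ_ R I J)
  module HR = HTheory rawRing rawLeftModule I

  I⊆I+J : ∀ {t} → I t → (_+ᴵ_ R I J) t
  I⊆I+J {t} p = (t , 0# , p , *ₗ-zeroˡ , sym (+-identityʳ t))

  Z-constant-mod-ann : ∀ {φ} → HR.IsHom φ → HR.IsLocal φ →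
                       ∀ {a a'} (a∈I : I a) (a'∈I : I a') → a ≡ a' mod → φ a a∈I ≈ᴹ φ a' a'∈I
  Z-constant-mod-ann {φ} h loc {a} {a'} a∈I a'∈I j = begin
    φ a a∈I                                      ≈⟨ HR.IsHom.cong h a∈I (II.+∈ d a'∈I) (sym (//-rightDividesˡ a' a)) ⟩
    φ ((a - a') + a') (II.+∈ d a'∈I)             ≈⟨ HR.IsHom.additive h d a'∈I _ ⟩
    φ (a - a') d +ᴹ φ a' a'∈I                    ≈⟨ +ᴹ-congʳ (proj₂ (loc (a - a') d)) ⟩
    ((a - a') *ₗ proj₁ (loc (a - a') d)) +ᴹ φ a' a'∈I ≈⟨ +ᴹ-congʳ (j _) ⟩
    0ᴹ +ᴹ φ a' a'∈I                              ≈⟨ +ᴹ-identityˡ _ ⟩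
    φ a' a'∈I                                    ∎
    where
    open SetoidReasoning ≈ᴹ-setoid
    d = II.+∈ a∈I (CI.-∈ a'∈I)

  restrict-Z : ∀ ψ → HQ.IsZ ψ → HR.IsZ (restrict R M I ψ)
  restrict-Z ψ (h , loc) = record
    { cong        = λ p q e → HQ.IsHom.cong h (I⊆I+J p) (I⊆I+J q) (≈⇒≡ e)
    ; additive    = λ p q r → HQ.IsHom.additive h (I⊆I+J p) (I⊆I+J q) (I⊆I+J r)
    ; homogeneous = λ a p q → HQ.IsHom.homogeneous h a (I⊆I+J p) (I⊆I+J q)
    } , λ t p → loc t (I⊆I+J p)

  -- a Z-map on (I+J)/J is determined by its restriction: ψ(a + b) = ψ(a)
  injective : ∀ ψ ψ' → HQ.IsZ ψ → HQ.IsZ ψ' →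
              HR._∼_ (restrict R M I ψ) (restrict R M I ψ') → ψ HQ.∼ ψ'
  injective ψ ψ' (h , _) (h' , _) (m , e) = m , λ { x q@(a , b , a∈I , b∈J , x≈a+b) →
    let x≡a = ≡-summand x≈a+b b∈J
    in ≈ᴹ-trans (+ᴹ-cong (HQ.IsHom.cong h q (I⊆I+J a∈I) x≡a) (-ᴹ‿cong (HQ.IsHom.cong h' q (I⊆I+J a∈I) x≡a)))
                (≈ᴹ-trans (e a a∈I) (≈ᴹ-sym (≡⇒same-action x≡a m))) }

  extend : HR.Fn → HQ.Fn
  extend φ x (a , _ , a∈I , _) = φ a a∈I

  extend-Z : ∀ φ → HR.IsZ φ → HQ.IsZ (extend φ)
  extend-Z φ (h , loc) = record
    { cong = λ { (a , b , a∈I , b∈J , x≈) (a' , b' , a'∈I , b'∈J , y≈) x≡y →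
        constant a∈I a'∈I (≡-trans (≡-sym (≡-summand x≈ b∈J)) (≡-trans x≡y (≡-summand y≈ b'∈J))) }
    ; additive = λ { (a , b , a∈I , b∈J , x≈) (a' , b' , a'∈I , b'∈J , y≈) (c , d , c∈I , d∈J , s≈) →
        ≈ᴹ-trans (constant c∈I (II.+∈ a∈I a'∈I)
                   (≡-trans (≡-sym (≡-summand s≈ d∈J)) (≡-+ (≡-summand x≈ b∈J) (≡-summand y≈ b'∈J))))
                 (HR.IsHom.additive h a∈I a'∈I _) }
    ; homogeneous = λ { r (a , b , a∈I , b∈J , x≈) (c , d , c∈I , d∈J , s≈) →
        ≈ᴹ-trans (constant c∈I (II.*∈ r a∈I) (≡-trans (≡-sym (≡-summand s≈ d∈J)) (≡-* r (≡-summand x≈ b∈J))))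
                 (HR.IsHom.homogeneous h r a∈I _) }
    } , λ { x (a , b , a∈I , b∈J , x≈) →
        proj₁ (loc a a∈I) , ≈ᴹ-trans (proj₂ (loc a a∈I)) (≈ᴹ-sym (≡⇒same-action (≡-summand x≈ b∈J) _)) }
    where constant = Z-constant-mod-ann h loc

  iso : IsIso (H_quot R M I J) (H_R R M I) (restrict R M I)
  iso = record
    { good = restrict-Z
    ; resp = λ ψ ψ' _ _ (m , e) → m , λ t p → e t (I⊆I+J p)
    ; add  = λ _ _ _ _ → pointwise⇒∼ (λ t p → ≈ᴹ-refl)
    ; hom  = λ _ _ _ → pointwise⇒∼ (λ t p → ≈ᴹ-refl)
    ; inj  = injective
    ; surj = λ φ z → extend φ , extend-Z φ z , pointwise⇒∼ (λ t p → ≈ᴹ-refl)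
    }

module LocalRing (R : CommutativeRing 0ℓ 0ℓ) (S : Pred (CommutativeRing.Carrier R) 0ℓ)
                 (mS : IsMultSet R S) where
  open CommutativeRing R hiding (zero)
  open import Algebra.Solver.Ring.NaturalCoefficients.Default commutativeSemiring
  open SetoidReasoning setoid
  open Loc R S mS
  module LR = RawRing locRing

  ≈L-refl : ∀ {x} → x LR.≈ x
  ≈L-refl = 1D , refl

  ≈L-sym : ∀ {x y} → x LR.≈ y → y LR.≈ x
  ≈L-sym (v , e) = v , sym e

  ≈L-trans : ∀ {x y z} → x LR.≈ y → y LR.≈ z → x LR.≈ z
  ≈L-trans {a , s} {b , u} {c , w} (v , e) (v' , e') = (v *D v') *D u , (begin
    ((V * V') * U) * W * a    ≈⟨ solve 5 (λ V V' U W a → ((V :* V') :* U) :* W :* a := (V' :* W) :* ((V :* U) :* a)) refl V V' U W a ⟩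
    (V' * W) * ((V * U) * a)  ≈⟨ *-congˡ e ⟩
    (V' * W) * ((V * s₁) * b) ≈⟨ solve 5 (λ V V' W s₁ b → (V' :* W) :* ((V :* s₁) :* b) := (V :* s₁) :* ((V' :* W) :* b)) refl V V' W s₁ b ⟩
    (V * s₁) * ((V' * W) * b) ≈⟨ *-congˡ e' ⟩
    (V * s₁) * ((V' * U) * c) ≈⟨ solve 5 (λ V V' U s₁ c → (V :* s₁) :* ((V' :* U) :* c) := ((V :* V') :* U) :* s₁ :* c) refl V V' U s₁ c ⟩
    ((V * V') * U) * s₁ * c   ∎)
    where V = proj₁ v ; V' = proj₁ v' ; U = proj₁ u ; W = proj₁ w ; s₁ = proj₁ s

  +L-cong : ∀ {x x' y y'} → x LR.≈ x' → y LR.≈ y' → (x LR.+ y) LR.≈ (x' LR.+ y')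
  +L-cong {a , s} {a' , s'} {b , u} {b' , u'} (v , e) (v' , e') = v *D v' , (begin
    (V * V') * (S' * U') * (a * U + b * s₁)
      ≈⟨ solve 8 (λ V V' S' U' a U b s₁ → (V :* V') :* (S' :* U') :* (a :* U :+ b :* s₁)
                   := (V' :* U :* U') :* ((V :* S') :* a) :+ (V :* s₁ :* S') :* ((V' :* U') :* b)) refl V V' S' U' a U b s₁ ⟩
    (V' * U * U') * ((V * S') * a) + (V * s₁ * S') * ((V' * U') * b) ≈⟨ +-cong (*-congˡ e) (*-congˡ e') ⟩
    (V' * U * U') * ((V * s₁) * a') + (V * s₁ * S') * ((V' * U) * b')
      ≈⟨ solve 8 (λ V V' S' U' a' U b' s₁ → (V' :* U :* U') :* ((V :* s₁) :* a') :+ (V :* s₁ :* S') :* ((V' :* U) :* b')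
                   := (V :* V') :* (s₁ :* U) :* (a' :* U' :+ b' :* S')) refl V V' S' U' a' U b' s₁ ⟩
    (V * V') * (s₁ * U) * (a' * U' + b' * S') ∎)
    where V = proj₁ v ; V' = proj₁ v' ; U = proj₁ u ; U' = proj₁ u' ; s₁ = proj₁ s ; S' = proj₁ s'

  *L-congˡ : ∀ r {x y} → x LR.≈ y → (r LR.* x) LR.≈ (r LR.* y)
  *L-congˡ (r , w) {a , s} {b , u} (v , e) = v , (begin
    V * (W * U) * (r * a)    ≈⟨ solve 5 (λ V W U r a → V :* (W :* U) :* (r :* a) := (W :* r) :* ((V :* U) :* a)) refl V W U r a ⟩
    (W * r) * ((V * U) * a)  ≈⟨ *-congˡ e ⟩
    (W * r) * ((V * s₁) * b) ≈⟨ solve 5 (λ V W s₁ r b → (W :* r) :* ((V :* s₁) :* b) := V :* (W :* s₁) :* (r :* b)) refl V W s₁ r b ⟩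
    V * (W * s₁) * (r * b)   ∎)
    where V = proj₁ v ; W = proj₁ w ; U = proj₁ u ; s₁ = proj₁ s

  ∏D : ∀ n → (Fin n → Den) → Den
  ∏D zero    v = 1D
  ∏D (suc n) v = v zero *D ∏D n (λ i → v (suc i))

  ∏D-factor : ∀ n (v : Fin n → Den) (i : Fin n) → Σ Carrier (λ Q → proj₁ (∏D n v) ≈ Q * proj₁ (v i))
  ∏D-factor (suc n) v zero = proj₁ (∏D n (λ i → v (suc i))) , *-comm _ _
  ∏D-factor (suc n) v (suc i) with ∏D-factor n (λ j → v (suc j)) i
  ... | Q , e = proj₁ (v zero) * Q , trans (*-congˡ e) (sym (*-assoc _ _ _))

-- It is well defined and linear for any ideal; injectivity uses finite
-- generation: if φ/s and ψ/s' agree, then on each generator gᵢ some vᵢ ∈ S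
-- makes vᵢ(s'φ - sψ)(gᵢ) principal with a common witness, so the product V of
-- the vᵢ makes V(s'φ - sψ) principal on the generators, hence principal.
module LocalisationMap (R : CommutativeRing 0ℓ 0ℓ) (S : Pred (CommutativeRing.Carrier R) 0ℓ)
                       (mS : IsMultSet R S) (I : Pred (CommutativeRing.Carrier R) 0ℓ)
                       (isI : IsIdeal R I) (M : Module R 0ℓ 0ℓ) where
  open CommutativeRing R hiding (zero)
  open Module M
  open import Algebra.Solver.Ring.NaturalCoefficients.Default commutativeSemiring
  open Loc R S mS
  open LocalRing R S mS
  open ScalarFacts M
  open HomFacts R I M using (⊖-hom; ∙-hom)
  module LM = RawLeftModule (locModule M)
  module HR = HTheory rawRing rawLeftModule I
  module HL = HTheory locRing (locModule M) (locIdeal I)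
  module II = IsIdeal isI
  module RR = SetoidReasoning setoid
  open SetoidReasoning ≈ᴹ-setoid

  combination-cong : ∀ {α α' β β'} X Y → α ≈ α' → β ≈ β' →
                     ((α *ₗ X) +ᴹ (β *ₗ Y)) ≈ᴹ ((α' *ₗ X) +ᴹ (β' *ₗ Y))
  combination-cong X Y e e' = +ᴹ-cong (*ₗ-congʳ e) (*ₗ-congʳ e')

  module Linear (φ : HR.Fn) (h : HR.IsHom φ) where
    scalar-in : ∀ r {a} (a∈I : I a) → (r *ₗ φ a a∈I) ≈ᴹ φ (r * a) (II.*∈ r a∈I)
    scalar-in r a∈I = ≈ᴹ-sym (HR.IsHom.homogeneous h r a∈I _)

    combination-in : ∀ r r' {a b} (a∈I : I a) (b∈I : I b) →
      ((r *ₗ φ a a∈I) +ᴹ (r' *ₗ φ b b∈I)) ≈ᴹ φ (r * a + r' * b) (II.+∈ (II.*∈ r a∈I) (II.*∈ r' b∈I))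
    combination-in r r' a∈I b∈I =
      ≈ᴹ-trans (+ᴹ-cong (scalar-in r a∈I) (scalar-in r' b∈I)) (≈ᴹ-sym (HR.IsHom.additive h _ _ _))

  module Image (φ : HR.Fn) (s : Den) (h : HR.IsHom φ) (loc : HR.IsLocal φ) where
    open Linear φ h
    s₁ : Carrier
    s₁ = proj₁ s

    image-cong : ∀ {a b u u'} (a∈I : I a) (b∈I : I b) → (a , u) LR.≈ (b , u') →
                 (φ a a∈I , s *D u) LM.≈ᴹ (φ b b∈I , s *D u')
    image-cong {a} {b} {u} {u'} a∈I b∈I (v , e) = v , (begin
      (V * (s₁ * U')) *ₗ φ a a∈I ≈⟨ scalar-in _ a∈I ⟩
      φ _ _ ≈⟨ HR.IsHom.cong h _ _ (RR.begin
         (V * (s₁ * U')) * a RR.≈⟨ solve 4 (λ V s₁ U' a → (V :* (s₁ :* U')) :* a := s₁ :* ((V :* U') :* a)) refl V s₁ U' a ⟩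
         s₁ * ((V * U') * a) RR.≈⟨ *-congˡ e ⟩
         s₁ * ((V * U) * b)  RR.≈⟨ solve 4 (λ V s₁ U b → s₁ :* ((V :* U) :* b) := (V :* (s₁ :* U)) :* b) refl V s₁ U b ⟩
         (V * (s₁ * U)) * b  RR.∎) ⟩
      φ _ _ ≈⟨ scalar-in _ b∈I ⟨
      (V * (s₁ * U)) *ₗ φ b b∈I ∎)
      where V = proj₁ v ; U = proj₁ u ; U' = proj₁ u'

    image-additive : ∀ {a b c u u' u''} (a∈I : I a) (b∈I : I b) (c∈I : I c) →
                     (c , u'') LR.≈ ((a , u) LR.+ (b , u')) →
                     (φ c c∈I , s *D u'') LM.≈ᴹ ((φ a a∈I , s *D u) LM.+ᴹ (φ b b∈I , s *D u'))
    image-additive {a} {b} {c} {u} {u'} {u''} a∈I b∈I c∈I (v , e) = v , (begin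
      (V * ((s₁ * U) * (s₁ * U'))) *ₗ φ c c∈I ≈⟨ scalar-in _ c∈I ⟩
      φ _ _ ≈⟨ HR.IsHom.cong h _ _ (RR.begin
         (V * ((s₁ * U) * (s₁ * U'))) * c
           RR.≈⟨ solve 5 (λ V s₁ U U' c → (V :* ((s₁ :* U) :* (s₁ :* U'))) :* c := (s₁ :* s₁) :* ((V :* (U :* U')) :* c)) refl V s₁ U U' c ⟩
         (s₁ * s₁) * ((V * (U * U')) * c) RR.≈⟨ *-congˡ e ⟩
         (s₁ * s₁) * ((V * U'') * (a * U' + b * U))
           RR.≈⟨ solve 7 (λ V s₁ U U' U'' a b → (s₁ :* s₁) :* ((V :* U'') :* (a :* U' :+ b :* U))
                          := ((V :* (s₁ :* U'')) :* (s₁ :* U')) :* a :+ ((V :* (s₁ :* U'')) :* (s₁ :* U)) :* b) refl V s₁ U U' U'' a b ⟩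
         ((V * (s₁ * U'')) * (s₁ * U')) * a + ((V * (s₁ * U'')) * (s₁ * U)) * b RR.∎) ⟩
      φ _ _ ≈⟨ combination-in _ _ a∈I b∈I ⟨
      (((V * (s₁ * U'')) * (s₁ * U')) *ₗ φ a a∈I) +ᴹ (((V * (s₁ * U'')) * (s₁ * U)) *ₗ φ b b∈I) ≈⟨ *ₗ-combination _ _ _ _ _ ⟨
      (V * (s₁ * U'')) *ₗ (((s₁ * U') *ₗ φ a a∈I) +ᴹ ((s₁ * U) *ₗ φ b b∈I)) ∎)
      where V = proj₁ v ; U = proj₁ u ; U' = proj₁ u' ; U'' = proj₁ u''

    image-homogeneous : ∀ r w {a c u u''} (a∈I : I a) (c∈I : I c) → (c , u'') LR.≈ (r * a , w *D u) →
                        (φ c c∈I , s *D u'') LM.≈ᴹ (r *ₗ φ a a∈I , w *D (s *D u))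
    image-homogeneous r w {a} {c} {u} {u''} a∈I c∈I (v , e) = v , (begin
      (V * (W * (s₁ * U))) *ₗ φ c c∈I ≈⟨ scalar-in _ c∈I ⟩
      φ _ _ ≈⟨ HR.IsHom.cong h _ _ (RR.begin
         (V * (W * (s₁ * U))) * c RR.≈⟨ solve 5 (λ V W s₁ U c → (V :* (W :* (s₁ :* U))) :* c := s₁ :* ((V :* (W :* U)) :* c)) refl V W s₁ U c ⟩
         s₁ * ((V * (W * U)) * c) RR.≈⟨ *-congˡ e ⟩
         s₁ * ((V * U'') * (r * a)) RR.≈⟨ solve 5 (λ V s₁ U'' r a → s₁ :* ((V :* U'') :* (r :* a)) := ((V :* (s₁ :* U'')) :* r) :* a) refl V s₁ U'' r a ⟩
         ((V * (s₁ * U'')) * r) * a RR.∎) ⟩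
      φ _ _ ≈⟨ scalar-in _ a∈I ⟨
      ((V * (s₁ * U'')) * r) *ₗ φ a a∈I ≈⟨ *ₗ-assoc _ _ _ ⟩
      (V * (s₁ * U'')) *ₗ (r *ₗ φ a a∈I) ∎)
      where V = proj₁ v ; W = proj₁ w ; U = proj₁ u ; U'' = proj₁ u''

    image-hom : HL.IsHom (locMap M I (φ , s))
    image-hom = record
      { cong = λ { {x} {y} (a , a∈I , u , x≈) (b , b∈I , u' , y≈) x≈y →
          image-cong {a} {b} {u} {u'} a∈I b∈I (≈L-trans {a , u} {x} {b , u'} (≈L-sym {x} {a , u} x≈) (≈L-trans {x} {y} {b , u'} x≈y y≈)) }
      ; additive = λ { {x} {y} (a , a∈I , u , x≈) (b , b∈I , u' , y≈) (c , c∈I , u'' , z≈) →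
          image-additive {a} {b} {c} {u} {u'} {u''} a∈I b∈I c∈I (≈L-trans {c , u''} {x LR.+ y} {(a , u) LR.+ (b , u')}
            (≈L-sym {x LR.+ y} {c , u''} z≈) (+L-cong {x} {a , u} {y} {b , u'} x≈ y≈)) }
      ; homogeneous = λ { (r , w) {x} (a , a∈I , u , x≈) (c , c∈I , u'' , z≈) →
          image-homogeneous r w {a} {c} {u} {u''} a∈I c∈I (≈L-trans {c , u''} {(r , w) LR.* x} {(r , w) LR.* (a , u)}
            (≈L-sym {(r , w) LR.* x} {c , u''} z≈) (*L-congˡ (r , w) {x} {a , u} x≈)) }
      }

    -- φ(a) = a n gives φ(a)/(su) = (x₁/x₂)(n/s) whenever x₁/x₂ = a/u
    image-local : HL.IsLocal (locMap M I (φ , s))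
    image-local (x₁ , x₂) (a , a∈I , u , (v , e)) = (n , s) , v , (begin
      (V * (X₂ * s₁)) *ₗ φ a a∈I ≈⟨ *ₗ-congˡ (proj₂ (loc a a∈I)) ⟩
      (V * (X₂ * s₁)) *ₗ (a *ₗ n) ≈⟨ *ₗ-assoc _ _ _ ⟨
      ((V * (X₂ * s₁)) * a) *ₗ n ≈⟨ *ₗ-congʳ (RR.begin
         (V * (X₂ * s₁)) * a RR.≈⟨ solve 4 (λ V X₂ s₁ a → (V :* (X₂ :* s₁)) :* a := s₁ :* ((V :* X₂) :* a)) refl V X₂ s₁ a ⟩
         s₁ * ((V * X₂) * a) RR.≈⟨ *-congˡ (sym e) ⟩
         s₁ * ((V * U) * x₁) RR.≈⟨ solve 4 (λ V s₁ U x₁ → s₁ :* ((V :* U) :* x₁) := (V :* (s₁ :* U)) :* x₁) refl V s₁ U x₁ ⟩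
         (V * (s₁ * U)) * x₁ RR.∎) ⟩
      ((V * (s₁ * U)) * x₁) *ₗ n ≈⟨ *ₗ-assoc _ _ _ ⟩
      (V * (s₁ * U)) *ₗ (x₁ *ₗ n) ∎)
      where V = proj₁ v ; X₂ = proj₁ x₂ ; U = proj₁ u ; n = proj₁ (loc a a∈I)

  equal-fractions-∼ : ∀ A σ B τ x → (proj₁ τ *ₗ A) ≈ᴹ (proj₁ σ *ₗ B) →
                      ((A , σ) LM.+ᴹ (LM.-ᴹ (B , τ))) LM.≈ᴹ (x LM.*ₗ LM.0ᴹ)
  equal-fractions-∼ A σ B τ (x₁ , x₂) τA≈σB = 1D , ≈ᴹ-trans (*ₗ-congˡ numerator≈0) (≈ᴹ-trans (*ₗ-zeroʳ _)
      (≈ᴹ-sym (≈ᴹ-trans (*ₗ-congˡ (*ₗ-zeroʳ x₁)) (*ₗ-zeroʳ _))))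
    where
    numerator≈0 : ((proj₁ τ *ₗ A) +ᴹ (proj₁ σ *ₗ (-ᴹ B))) ≈ᴹ 0ᴹ
    numerator≈0 = ≈ᴹ-trans (+ᴹ-cong τA≈σB (*ₗ-neg _ B)) (-ᴹ‿inverseʳ _)

  Source : PMod LCarrier
  Source = locP (H_R R M I)

  Target : PMod LCarrier
  Target = H_loc M I

  map : PMod.Elt Source → PMod.Elt Target
  map = locMap M I

  -- well defined on classes: if V(s'φ - sψ) is principal with witness m, so is
  -- the difference of the images, with witness m/(Vss')
  map-respects : ∀ x y → PMod.Good Source x → PMod.Good Source y → PMod._≈_ Source x y →
                 PMod._≈_ Target (map x) (map y)
  map-respects (φ , s) (ψ , s') _ _ (v , m , E) = (m , (v *D s) *D s') , λ { (x₁ , x₂) (a , a∈I , u , (v' , e)) →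
     let V = proj₁ v ; V' = proj₁ v' ; X₂ = proj₁ x₂ ; U = proj₁ u ; s₁ = proj₁ s ; S' = proj₁ s'
         K = V' * X₂ * s₁ * S' * U
         L = V' * (X₂ * ((V * s₁) * S'))
     in v' , (begin
       L *ₗ (((S' * U) *ₗ φ a a∈I) +ᴹ ((s₁ * U) *ₗ (-ᴹ ψ a a∈I))) ≈⟨ *ₗ-combination _ _ _ _ _ ⟩
       ((L * (S' * U)) *ₗ φ a a∈I) +ᴹ ((L * (s₁ * U)) *ₗ (-ᴹ ψ a a∈I)) ≈⟨ combination-cong _ _
           (solve 6 (λ V V' X₂ s₁ S' U → (V' :* (X₂ :* ((V :* s₁) :* S'))) :* (S' :* U) := (V' :* X₂ :* s₁ :* S' :* U) :* (V :* S')) refl V V' X₂ s₁ S' U)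
           (solve 6 (λ V V' X₂ s₁ S' U → (V' :* (X₂ :* ((V :* s₁) :* S'))) :* (s₁ :* U) := (V' :* X₂ :* s₁ :* S' :* U) :* (V :* s₁)) refl V V' X₂ s₁ S' U) ⟩
       ((K * (V * S')) *ₗ φ a a∈I) +ᴹ ((K * (V * s₁)) *ₗ (-ᴹ ψ a a∈I)) ≈⟨ *ₗ-combination _ _ _ _ _ ⟨
       K *ₗ (((V * S') *ₗ φ a a∈I) +ᴹ ((V * s₁) *ₗ (-ᴹ ψ a a∈I))) ≈⟨ *ₗ-congˡ (+ᴹ-congˡ (*ₗ-neg _ _)) ⟩
       K *ₗ (((V * S') *ₗ φ a a∈I) +ᴹ (-ᴹ ((V * s₁) *ₗ ψ a a∈I))) ≈⟨ *ₗ-congˡ (E a a∈I) ⟩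
       K *ₗ (a *ₗ m) ≈⟨ *ₗ-assoc _ _ _ ⟨
       (K * a) *ₗ m ≈⟨ *ₗ-congʳ (RR.begin
           K * a RR.≈⟨ solve 6 (λ V' X₂ s₁ S' U a → (V' :* X₂ :* s₁ :* S' :* U) :* a := (s₁ :* S' :* U) :* ((V' :* X₂) :* a)) refl V' X₂ s₁ S' U a ⟩
           (s₁ * S' * U) * ((V' * X₂) * a) RR.≈⟨ *-congˡ (sym e) ⟩
           (s₁ * S' * U) * ((V' * U) * x₁) RR.≈⟨ solve 5 (λ V' s₁ S' U x₁ → (s₁ :* S' :* U) :* ((V' :* U) :* x₁) := (V' :* ((s₁ :* U) :* (S' :* U))) :* x₁) refl V' s₁ S' U x₁ ⟩
           (V' * ((s₁ * U) * (S' * U))) * x₁ RR.∎) ⟩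
       ((V' * ((s₁ * U) * (S' * U))) * x₁) *ₗ m ≈⟨ *ₗ-assoc _ _ _ ⟩
       (V' * ((s₁ * U) * (S' * U))) *ₗ (x₁ *ₗ m) ∎) }

  -- additivity and homogeneity hold on the nose, up to equal fractions
  map-additive : ∀ x y → PMod.Good Source x → PMod.Good Source y →
                 PMod._≈_ Target (map (PMod._+_ Source x y)) (PMod._+_ Target (map x) (map y))
  map-additive (φ , s) (ψ , s') _ _ = LM.0ᴹ , λ { z (a , a∈I , u , _) →
      equal-fractions-∼ _ ((s *D s') *D u) _ ((s *D u) *D (s' *D u)) z
        (≈ᴹ-trans (*ₗ-combination _ _ _ _ _) (≈ᴹ-trans (combination-cong _ _
           (solve 3 (λ s₁ S' U → ((s₁ :* U) :* (S' :* U)) :* S' := ((s₁ :* S') :* U) :* (S' :* U)) refl (proj₁ s) (proj₁ s') (proj₁ u))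
           (solve 3 (λ s₁ S' U → ((s₁ :* U) :* (S' :* U)) :* s₁ := ((s₁ :* S') :* U) :* (s₁ :* U)) refl (proj₁ s) (proj₁ s') (proj₁ u)))
         (≈ᴹ-sym (*ₗ-combination _ _ _ _ _)))) }

  map-homogeneous : ∀ a x → PMod.Good Source x → PMod._≈_ Target (map (PMod._·_ Source a x)) (PMod._·_ Target a (map x))
  map-homogeneous (r , w) (φ , s) _ = LM.0ᴹ , λ { z (a , a∈I , u , _) →
      equal-fractions-∼ _ ((w *D s) *D u) _ (w *D (s *D u)) z
        (*ₗ-congʳ (solve 3 (λ W s₁ U → W :* (s₁ :* U) := (W :* s₁) :* U) refl (proj₁ w) (proj₁ s) (proj₁ u))) }

  map-injective : FinGen R I → ∀ x y → PMod.Good Source x → PMod.Good Source y →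
                  PMod._≈_ Target (map x) (map y) → PMod._≈_ Source x y
  map-injective fg (φ , s) (ψ , s') (hφ , _) (hψ , _) ((m , w) , E) =
    w *D V , (P * (s₁ * S')) *ₗ m ,
    principal-on-generators _ (⊖-hom (∙-hom _ hφ) (∙-hom _ hψ)) _ principal-on-gen
    where
    open Generators R fg
    open HomFacts.FinitelyGenerated R I M isI fg
    s₁ = proj₁ s ; S' = proj₁ s' ; W = proj₁ w
    gen/1 : Fin #gen → LCarrier
    gen/1 i = gen i , 1D
    gen/1∈ : ∀ i → locIdeal I (gen/1 i)
    gen/1∈ i = gen i , gen∈I i , 1D , ≈L-refl {gen/1 i}
    at-gen : ∀ i → (map (φ , s) (gen/1 i) (gen/1∈ i) LM.+ᴹ (LM.-ᴹ map (ψ , s') (gen/1 i) (gen/1∈ i)))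
                   LM.≈ᴹ (gen/1 i LM.*ₗ (m , w))
    at-gen i = E (gen/1 i) (gen/1∈ i)
    vs : Fin #gen → Den
    vs i = proj₁ (at-gen i)
    V = ∏D #gen vs
    P = proj₁ V
    principal-on-gen : ∀ i → (((W * P) * S') *ₗ φ (gen i) (gen∈I i)) +ᴹ (-ᴹ (((W * P) * s₁) *ₗ ψ (gen i) (gen∈I i)))
                             ≈ᴹ (gen i *ₗ ((P * (s₁ * S')) *ₗ m))
    principal-on-gen i = begin
      (((W * P) * S') *ₗ φg) +ᴹ (-ᴹ (((W * P) * s₁) *ₗ ψg)) ≈⟨ +ᴹ-congˡ (*ₗ-neg _ _) ⟨
      (((W * P) * S') *ₗ φg) +ᴹ (((W * P) * s₁) *ₗ (-ᴹ ψg)) ≈⟨ combination-cong _ _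
         (trans (*-congʳ (*-congˡ P≈Qv)) (solve 4 (λ W Q v S' → (W :* (Q :* v)) :* S' := (Q :* (v :* (con 1 :* W))) :* (S' :* con 1)) refl W Q v S'))
         (trans (*-congʳ (*-congˡ P≈Qv)) (solve 4 (λ W Q v s₁ → (W :* (Q :* v)) :* s₁ := (Q :* (v :* (con 1 :* W))) :* (s₁ :* con 1)) refl W Q v s₁)) ⟩
      (((Q * (v * (1# * W))) * (S' * 1#)) *ₗ φg) +ᴹ (((Q * (v * (1# * W))) * (s₁ * 1#)) *ₗ (-ᴹ ψg)) ≈⟨ *ₗ-combination _ _ _ _ _ ⟨
      (Q * (v * (1# * W))) *ₗ (((S' * 1#) *ₗ φg) +ᴹ ((s₁ * 1#) *ₗ (-ᴹ ψg))) ≈⟨ *ₗ-assoc _ _ _ ⟩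
      Q *ₗ ((v * (1# * W)) *ₗ (((S' * 1#) *ₗ φg) +ᴹ ((s₁ * 1#) *ₗ (-ᴹ ψg)))) ≈⟨ *ₗ-congˡ (proj₂ (at-gen i)) ⟩
      Q *ₗ ((v * ((s₁ * 1#) * (S' * 1#))) *ₗ (gen i *ₗ m)) ≈⟨ *ₗ-congˡ (*ₗ-assoc _ _ _) ⟨
      Q *ₗ (((v * ((s₁ * 1#) * (S' * 1#))) * gen i) *ₗ m) ≈⟨ *ₗ-assoc _ _ _ ⟨
      (Q * ((v * ((s₁ * 1#) * (S' * 1#))) * gen i)) *ₗ m ≈⟨ *ₗ-congʳ
         (trans (solve 5 (λ Q v s₁ S' G → Q :* ((v :* ((s₁ :* con 1) :* (S' :* con 1))) :* G) := G :* ((Q :* v) :* (s₁ :* S'))) refl Q v s₁ S' (gen i))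
                (*-congˡ (*-congʳ (sym P≈Qv)))) ⟩
      (gen i * (P * (s₁ * S'))) *ₗ m ≈⟨ *ₗ-assoc _ _ _ ⟩
      gen i *ₗ ((P * (s₁ * S')) *ₗ m) ∎
      where
      φg = φ (gen i) (gen∈I i) ; ψg = ψ (gen i) (gen∈I i)
      v = proj₁ (vs i)
      Q = proj₁ (∏D-factor #gen vs i)
      P≈Qv : P ≈ Q * v
      P≈Qv = proj₂ (∏D-factor #gen vs i)

  embedding : FinGen R I → IsEmbedding Source Target map
  embedding fg = record
    { good = λ { (φ , s) (h , loc) → Image.image-hom φ s h loc , Image.image-local φ s h loc }
    ; resp = map-respects
    ; add  = map-additive
    ; hom  = map-homogeneous
    ; inj  = map-injective fg
    }

proposition5p5 : (R : CommutativeRing 0ℓ 0ℓ) (I : Pred (CommutativeRing.Carrier R) 0ℓ) → IsIdeal R I →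
    (M : Module R 0ℓ 0ℓ) (Λ : Set) (Ms : Λ → Module R 0ℓ 0ℓ) →
    IsIso (H_Π Λ Ms I) (ΠP Λ (λ l → H_R R (Ms l) I)) (mapΠ Λ Ms I)
    × (FinGen R I → IsIso (H_⊕ Λ Ms I) (⊕P Λ (λ l → H_R R (Ms l) I)) (map⊕ Λ Ms I))
    × IsIso (H_quot R M I (ann R M)) (H_R R M I) (restrict R M I)
    × ((S : Pred (CommutativeRing.Carrier R) 0ℓ) (mS : IsMultSet R S) → FinGen R I →
    IsEmbedding (Loc.locP R S mS (H_R R M I)) (Loc.H_loc R S mS M I) (Loc.locMap R S mS M I))
proposition5p5 R I isI M Λ Ms =
    Products.iso R I Λ Ms
  , (λ fg → DirectSums.iso R I isI Λ Ms fg)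
  , Restriction.iso R I isI M
  , (λ S mS fg → LocalisationMap.embedding R S mS I isI M fg)
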